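{- Consider the following two-player game. Fix integers $a,b$ (not necessarily positive) and a positive integer $n$. Two players $A$ and $B$ each start with a pile of $0$ chips (piles may become negative). They alternate turns, $A$ first; on each of his moves a player flips a fair coin, independently of everything else, to decide whether to add $a$ or $b$ chips to his own pile. The first player whose pile reaches at least $n$ chips wins. For a player, let $S_k$ be the number of chips in his pile after his $k$-th move ($S_0=0$), and let $q(n,k)=P(S_j<n \text{ for all } j=0,1,\dots,k)$ be the probability that he has not collected $n$ chips on or before his $k$-th move (so $q(n,0)=1$). Let $X$ be the number of moves (counted per player, i.e. the index $k$ of the round in which the game ends) required to end the game. Then the average duration of the game is \[ E[X]=\sum_{k=0}^{\infty} q(n,k)^2 . \]
   Context: The event that the game ends at the $k$-th turn has probability $q(n,k-1)r(n,k)+q(n,k)r(n,k)$, where $r(n,k)=P(S_k\ge n \text{ and } S_j<n \text{ for all } j=0,\dots,k-1)=q(n,k-1)-q(n,k)$ is the probability of collecting $n$ chips for the first time on the $k$-th move. -}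

module Defs where

open import Data.Bool using (Bool; true; false; if_then_else_; _∧_)
open import Data.Nat using (ℕ; zero; suc)
open import Data.Integer as ℤ using (ℤ; +_)
open import Data.Vec using (Vec; []; _∷_)
open import Data.Rational as ℚ using (ℚ; 0ℚ; 1ℚ; ½; _+_; _*_)
open import Relation.Nullary.Decidable using (⌊_⌋)

step : ℤ → ℤ → Bool → ℤ
step a b true  = a
step a b false = b

-- Expectation of a ℚ-valued function of k independent fair coin flips
-- (uniform measure on Bool^k).
Ecoin : (k : ℕ) → (Vec Bool k → ℚ) → ℚ
Ecoin zero    f = f []
Ecoin (suc k) f = ½ * (Ecoin k (λ v → f (true ∷ v)) + Ecoin k (λ v → f (false ∷ v)))

ind : Bool → ℚ
ind true  = 1ℚ
ind false = 0ℚ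

below : ℤ → ℤ → ℤ → ℤ → {k : ℕ} → Vec Bool k → Bool
below a b n s []       = ⌊ s ℤ.<? n ⌋
below a b n s (x ∷ xs) = ⌊ s ℤ.<? n ⌋ ∧ below a b n (s ℤ.+ step a b x) xs

q : ℤ → ℤ → ℕ → ℕ → ℚ
q a b n k = Ecoin k (λ v → ind (below a b (+ n) (+ 0) v))

-- Truncated duration min(X, m) of the game, given A's first m flips and
-- B's first m flips; sA, sB are the current piles. Round: A moves (wins if
-- pile ≥ n), then B moves (wins if pile ≥ n).
play : ℤ → ℤ → ℤ → ℤ → ℤ → {m : ℕ} → Vec Bool m → Vec Bool m → ℕ
play a b n sA sB []       []       = 0
play a b n sA sB (x ∷ xs) (y ∷ ys) =
  let sA' = sA ℤ.+ step a b x
      sB' = sB ℤ.+ step a b y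
  in if ⌊ n ℤ.≤? sA' ⌋ then 1
     else if ⌊ n ℤ.≤? sB' ⌋ then 1
     else suc (play a b n sA' sB' xs ys)

EXtrunc : ℤ → ℤ → ℕ → ℕ → ℚ
EXtrunc a b n m =
  Ecoin m (λ α → Ecoin m (λ β → (+ play a b (+ n) (+ 0) (+ 0) α β) ℚ./ 1))

qsqSum : ℤ → ℤ → ℕ → ℕ → ℚ
qsqSum a b n zero    = 0ℚ
qsqSum a b n (suc L) = qsqSum a b n L + q a b n L * q a b n L

{-# OPTIONS --safe #-}
module Submission where

open import Defs
open import Data.Integer using (ℤ)
open import Data.Nat using (ℕ; _≤_)
open import Data.Product using (_×_; ∃-syntax)
open import Data.Rational as ℚ using ()

open import Data.Bool using (Bool; true; false; if_then_else_; _∧_; not)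
open import Data.Integer as ℤ using (+_)
import Data.Integer.Properties as ℤ
open import Data.Nat using (zero; suc; s≤s)
import Data.Nat.Coprimality as Coprimality
open import Data.Product using (_,_)
open import Data.Rational using (ℚ; 0ℚ; 1ℚ; ½; _+_; _*_; mkℚ)
open import Data.Rational.Properties
  using (normalize-coprime; *-comm; *-identityˡ; *-identityʳ; *-zeroˡ; *-zeroʳ; +-identityˡ; +-identityʳ; ≤-reflexive)
open import Data.Rational.Solver using (module +-*-Solver)
open import Data.Vec using (Vec; []; _∷_; head)
open import Relation.Binary.PropositionalEquality using (_≡_; refl; sym; trans; cong; cong₂; module ≡-Reasoning)
open import Relation.Nullary using (contradiction)
open import Relation.Nullary.Decidable using (⌊_⌋; yes; no)
open +-*-Solver using (solve; _:=_; _:+_; _:*_; con)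
open ≡-Reasoning

-- Conditioning on both players' first flips shows that P(X > k + 1) is the
-- average of P(X > k) over the four games restarted from the new piles, and
-- that min(X, m + 1) is 1 plus the average of the restarted min(X, m) on
-- the event that nobody has won yet.  Both quantities therefore satisfy the
-- same recursion, so E[min(X, m)] = Σ_{k<m} P(X > k) exactly, and
-- P(X > k) = q(n,k)² because the two players' piles are independent.

toℚ : ℕ → ℚ
toℚ k = (+ k) ℚ./ 1

toℚ-suc : ∀ k → toℚ (suc k) ≡ 1ℚ + toℚ k
toℚ-suc k = begin
  toℚ (suc k)                 ≡⟨ cong (λ z → (+ 1 ℤ.+ z) ℚ./ 1) (ℤ.*-identityʳ (+ k)) ⟨
  1ℚ + mkℚ (+ k) 0 k-coprime-1 ≡⟨ cong (λ z → 1ℚ + z) (normalize-coprime k-coprime-1) ⟨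
  1ℚ + toℚ k                  ∎
  where k-coprime-1 = Coprimality.sym (Coprimality.1-coprimeTo k)

ind-∧ : ∀ c d → ind (c ∧ d) ≡ ind c * ind d
ind-∧ true  d = sym (*-identityˡ (ind d))
ind-∧ false d = sym (*-zeroˡ (ind d))

Ecoin-cong : ∀ k {f g : Vec Bool k → ℚ} → (∀ v → f v ≡ g v) → Ecoin k f ≡ Ecoin k g
Ecoin-cong zero    f≗g = f≗g []
Ecoin-cong (suc k) f≗g = cong₂ (λ x y → ½ * (x + y))
  (Ecoin-cong k (λ v → f≗g (true ∷ v))) (Ecoin-cong k (λ v → f≗g (false ∷ v)))

Ecoin-const : ∀ k c → Ecoin k (λ _ → c) ≡ c
Ecoin-const zero    c = refl
Ecoin-const (suc k) c rewrite Ecoin-const k c =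
  solve 1 (λ c → con ½ :* (c :+ c) := c) refl c

Ecoin-+ : ∀ k (f g : Vec Bool k → ℚ) → Ecoin k (λ v → f v + g v) ≡ Ecoin k f + Ecoin k g
Ecoin-+ zero    f g = refl
Ecoin-+ (suc k) f g
  rewrite Ecoin-+ k (λ v → f (true ∷ v)) (λ v → g (true ∷ v))
        | Ecoin-+ k (λ v → f (false ∷ v)) (λ v → g (false ∷ v)) =
  solve 5 (λ h a b c d → h :* ((a :+ b) :+ (c :+ d)) := h :* (a :+ c) :+ h :* (b :+ d)) refl
    ½ (Ecoin k (λ v → f (true ∷ v))) (Ecoin k (λ v → g (true ∷ v)))
      (Ecoin k (λ v → f (false ∷ v))) (Ecoin k (λ v → g (false ∷ v)))

Ecoin-*ˡ : ∀ k c (f : Vec Bool k → ℚ) → Ecoin k (λ v → c * f v) ≡ c * Ecoin k f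
Ecoin-*ˡ zero    c f = refl
Ecoin-*ˡ (suc k) c f
  rewrite Ecoin-*ˡ k c (λ v → f (true ∷ v)) | Ecoin-*ˡ k c (λ v → f (false ∷ v)) =
  solve 4 (λ h c a b → h :* (c :* a :+ c :* b) := c :* (h :* (a :+ b))) refl
    ½ c (Ecoin k (λ v → f (true ∷ v))) (Ecoin k (λ v → f (false ∷ v)))

Ecoin-*ʳ : ∀ k c (f : Vec Bool k → ℚ) → Ecoin k (λ v → f v * c) ≡ Ecoin k f * c
Ecoin-*ʳ k c f = begin
  Ecoin k (λ v → f v * c) ≡⟨ Ecoin-cong k (λ v → *-comm (f v) c) ⟩
  Ecoin k (λ v → c * f v) ≡⟨ Ecoin-*ˡ k c f ⟩
  c * Ecoin k f           ≡⟨ *-comm c (Ecoin k f) ⟩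
  Ecoin k f * c           ∎

Ecoin-c+ : ∀ k c (f : Vec Bool k → ℚ) → Ecoin k (λ v → c + f v) ≡ c + Ecoin k f
Ecoin-c+ k c f = trans (Ecoin-+ k (λ _ → c) f) (cong (_+ Ecoin k f) (Ecoin-const k c))

Ecoin-affine : ∀ k c d (f : Vec Bool k → ℚ) →
  Ecoin k (λ v → c + d * f v) ≡ c + d * Ecoin k f
Ecoin-affine k c d f = trans (Ecoin-c+ k c (λ v → d * f v)) (cong (λ z → c + z) (Ecoin-*ˡ k d f))

Ecoin-comm : ∀ j k (f : Vec Bool j → Vec Bool k → ℚ) →
  Ecoin j (λ u → Ecoin k (λ v → f u v)) ≡ Ecoin k (λ v → Ecoin j (λ u → f u v))
Ecoin-comm zero    k f = refl
Ecoin-comm (suc j) k f = begin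
  ½ * (Ecoin j (λ u → Ecoin k (f (true ∷ u))) + Ecoin j (λ u → Ecoin k (f (false ∷ u))))
    ≡⟨ cong₂ (λ x y → ½ * (x + y))
         (Ecoin-comm j k (λ u → f (true ∷ u))) (Ecoin-comm j k (λ u → f (false ∷ u))) ⟩
  ½ * (Ecoin k (λ v → Ecoin j (λ u → f (true ∷ u) v)) + Ecoin k (λ v → Ecoin j (λ u → f (false ∷ u) v)))
    ≡⟨ cong (½ *_) (Ecoin-+ k _ _) ⟨
  ½ * Ecoin k (λ v → Ecoin j (λ u → f (true ∷ u) v) + Ecoin j (λ u → f (false ∷ u) v))
    ≡⟨ Ecoin-*ˡ k ½ _ ⟨
  Ecoin k (λ v → Ecoin (suc j) (λ u → f u v))
    ∎

Ecoin-*-Ecoin : ∀ j k (f : Vec Bool j → ℚ) (g : Vec Bool k → ℚ) →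
  Ecoin j f * Ecoin k g ≡ Ecoin j (λ u → Ecoin k (λ v → f u * g v))
Ecoin-*-Ecoin j k f g = begin
  Ecoin j f * Ecoin k g                        ≡⟨ Ecoin-*ʳ j (Ecoin k g) f ⟨
  Ecoin j (λ u → f u * Ecoin k g)              ≡⟨ Ecoin-cong j (λ u → Ecoin-*ˡ k (f u) g) ⟨
  Ecoin j (λ u → Ecoin k (λ v → f u * g v))    ∎

-- Ecoin (suc k) f unfolds definitionally to E₁ (λ x → Ecoin k (λ v → f (x ∷ v))).
E₁ : (Bool → ℚ) → ℚ
E₁ f = Ecoin 1 (λ v → f (head v))

E₁-cong : ∀ {f g : Bool → ℚ} → (∀ x → f x ≡ g x) → E₁ f ≡ E₁ g
E₁-cong f≗g = Ecoin-cong 1 (λ v → f≗g (head v))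

E₁-+ : ∀ (f g : Bool → ℚ) → E₁ (λ x → f x + g x) ≡ E₁ f + E₁ g
E₁-+ f g = Ecoin-+ 1 (λ v → f (head v)) (λ v → g (head v))

E₁-*ˡ : ∀ c (f : Bool → ℚ) → E₁ (λ x → c * f x) ≡ c * E₁ f
E₁-*ˡ c f = Ecoin-*ˡ 1 c (λ v → f (head v))

E₁-c+ : ∀ c (f : Bool → ℚ) → E₁ (λ x → c + f x) ≡ c + E₁ f
E₁-c+ c f = Ecoin-c+ 1 c (λ v → f (head v))

Ecoin-E₁-comm : ∀ k (f : Bool → Vec Bool k → ℚ) →
  Ecoin k (λ v → E₁ (λ x → f x v)) ≡ E₁ (λ x → Ecoin k (f x))
Ecoin-E₁-comm k f = Ecoin-comm k 1 (λ v u → f (head u) v)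

E₂ : (Bool → Bool → ℚ) → ℚ
E₂ f = E₁ (λ x → E₁ (λ y → f x y))

E₁-*-E₁ : ∀ (f g : Bool → ℚ) → E₁ f * E₁ g ≡ E₂ (λ x y → f x * g y)
E₁-*-E₁ f g = Ecoin-*-Ecoin 1 1 (λ v → f (head v)) (λ v → g (head v))

E₂-cong : ∀ {f g : Bool → Bool → ℚ} → (∀ x y → f x y ≡ g x y) → E₂ f ≡ E₂ g
E₂-cong f≗g = E₁-cong (λ x → E₁-cong (f≗g x))

E₂-+ : ∀ (f g : Bool → Bool → ℚ) → E₂ (λ x y → f x y + g x y) ≡ E₂ f + E₂ g
E₂-+ f g = trans (E₁-cong (λ x → E₁-+ (f x) (g x))) (E₁-+ (λ x → E₁ (f x)) (λ x → E₁ (g x)))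

E₂-c+ : ∀ c (f : Bool → Bool → ℚ) → E₂ (λ x y → c + f x y) ≡ c + E₂ f
E₂-c+ c f = trans (E₁-cong (λ x → E₁-c+ c (f x))) (E₁-c+ c (λ x → E₁ (f x)))

module Game (a b n : ℤ) where

  move : ℤ → Bool → ℤ
  move s x = s ℤ.+ step a b x

  alive : ℤ → ℚ
  alive s = ind ⌊ s ℤ.<? n ⌋

  survival : ℤ → ℕ → ℚ
  survival s k = Ecoin k (λ v → ind (below a b n s v))

  survival-suc : ∀ s k → survival s (suc k) ≡ alive s * E₁ (λ x → survival (move s x) k)
  survival-suc s k = begin
    E₁ (λ x → Ecoin k (λ v → ind (⌊ s ℤ.<? n ⌋ ∧ below a b n (move s x) v)))
      ≡⟨ E₁-cong (λ x → Ecoin-cong k (λ v → ind-∧ ⌊ s ℤ.<? n ⌋ (below a b n (move s x) v))) ⟩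
    E₁ (λ x → Ecoin k (λ v → alive s * ind (below a b n (move s x) v)))
      ≡⟨ E₁-cong (λ x → Ecoin-*ˡ k (alive s) (λ v → ind (below a b n (move s x) v))) ⟩
    E₁ (λ x → alive s * survival (move s x) k)
      ≡⟨ E₁-*ˡ (alive s) (λ x → survival (move s x) k) ⟩
    alive s * E₁ (λ x → survival (move s x) k)
      ∎

  -- P(X > k) for the game started from the piles sA, sB.
  joint : ℤ → ℤ → ℕ → ℚ
  joint sA sB k = survival sA k * survival sB k

  joint-suc : ∀ sA sB k →
    joint sA sB (suc k) ≡ alive sA * alive sB * E₂ (λ x y → joint (move sA x) (move sB y) k)
  joint-suc sA sB k = begin
    survival sA (suc k) * survival sB (suc k)
      ≡⟨ cong₂ _*_ (survival-suc sA k) (survival-suc sB k) ⟩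
    alive sA * E₁ (λ x → survival (move sA x) k) * (alive sB * E₁ (λ y → survival (move sB y) k))
      ≡⟨ solve 4 (λ p q r s → p :* r :* (q :* s) := p :* q :* (r :* s)) refl (alive sA) (alive sB) _ _ ⟩
    alive sA * alive sB * (E₁ (λ x → survival (move sA x) k) * E₁ (λ y → survival (move sB y) k))
      ≡⟨ cong (alive sA * alive sB *_) (E₁-*-E₁ (λ x → survival (move sA x) k) (λ y → survival (move sB y) k)) ⟩
    alive sA * alive sB * E₂ (λ x y → joint (move sA x) (move sB y) k)
      ∎

  jointSum : ℤ → ℤ → ℕ → ℚ
  jointSum sA sB zero    = 0ℚ
  jointSum sA sB (suc m) = jointSum sA sB m + joint sA sB m

  jointSum-suc : ∀ sA sB m → jointSum sA sB (suc m) ≡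
    alive sA * alive sB * (1ℚ + E₂ (λ x y → jointSum (move sA x) (move sB y) m))
  jointSum-suc sA sB zero =
    trans (+-identityˡ (alive sA * alive sB)) (sym (*-identityʳ (alive sA * alive sB)))
  jointSum-suc sA sB (suc m) = begin
    jointSum sA sB (suc m) + joint sA sB (suc m)
      ≡⟨ cong₂ _+_ (jointSum-suc sA sB m) (joint-suc sA sB m) ⟩
    p * (1ℚ + E₂ sumₘ) + p * E₂ jointₘ
      ≡⟨ solve 3 (λ p s j → p :* (con 1ℚ :+ s) :+ p :* j := p :* (con 1ℚ :+ (s :+ j))) refl
           p (E₂ sumₘ) (E₂ jointₘ) ⟩
    p * (1ℚ + (E₂ sumₘ + E₂ jointₘ))
      ≡⟨ cong (λ z → p * (1ℚ + z)) (E₂-+ sumₘ jointₘ) ⟨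
    p * (1ℚ + E₂ (λ x y → jointSum (move sA x) (move sB y) (suc m)))
      ∎
    where
    p = alive sA * alive sB
    sumₘ jointₘ : Bool → Bool → ℚ
    sumₘ x y = jointSum (move sA x) (move sB y) m
    jointₘ x y = joint (move sA x) (move sB y) m

  duration : ℤ → ℤ → ℕ → ℚ
  duration sA sB m = Ecoin m (λ α → Ecoin m (λ β → toℚ (play a b n sA sB α β)))

  ≤?-not-<? : ∀ s → ⌊ n ℤ.≤? s ⌋ ≡ not ⌊ s ℤ.<? n ⌋
  ≤?-not-<? s with n ℤ.≤? s | s ℤ.<? n
  ... | yes n≤s | yes s<n = contradiction n≤s (ℤ.<⇒≱ s<n)
  ... | yes _   | no  _   = refl
  ... | no  _   | yes _   = refl
  ... | no  n≰s | no  s≮n = contradiction (ℤ.≰⇒> n≰s) s≮n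

  toℚ-round : ∀ c d k → toℚ (if not c then 1 else if not d then 1 else suc k) ≡ 1ℚ + ind (c ∧ d) * toℚ k
  toℚ-round true  true  k = trans (toℚ-suc k) (cong (λ z → 1ℚ + z) (sym (*-identityˡ (toℚ k))))
  toℚ-round true  false k = sym (trans (cong (λ z → 1ℚ + z) (*-zeroˡ (toℚ k))) (+-identityʳ 1ℚ))
  toℚ-round false d     k = sym (trans (cong (λ z → 1ℚ + z) (*-zeroˡ (toℚ k))) (+-identityʳ 1ℚ))

  play-suc : ∀ sA sB {m} x y (α β : Vec Bool m) →
    toℚ (play a b n sA sB (x ∷ α) (y ∷ β)) ≡
    1ℚ + alive (move sA x) * alive (move sB y) * toℚ (play a b n (move sA x) (move sB y) α β)
  play-suc sA sB x y α β
    rewrite ≤?-not-<? (move sA x) | ≤?-not-<? (move sB y) =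
    trans (toℚ-round ⌊ move sA x ℤ.<? n ⌋ ⌊ move sB y ℤ.<? n ⌋ k)
          (cong (λ z → 1ℚ + z * toℚ k) (ind-∧ ⌊ move sA x ℤ.<? n ⌋ ⌊ move sB y ℤ.<? n ⌋))
    where k = play a b n (move sA x) (move sB y) α β

  duration-suc : ∀ sA sB m → duration sA sB (suc m) ≡
    1ℚ + E₂ (λ x y → alive (move sA x) * alive (move sB y) * duration (move sA x) (move sB y) m)
  duration-suc sA sB m = begin
    E₁ (λ x → Ecoin m (λ α → E₁ (λ y → Ecoin m (λ β → P x y α β))))
      ≡⟨ E₁-cong (λ x → Ecoin-E₁-comm m (λ y α → Ecoin m (P x y α))) ⟩
    E₂ (λ x y → Ecoin m (λ α → Ecoin m (λ β → P x y α β)))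
      ≡⟨ E₂-cong (λ x y → Ecoin-cong m (λ α →
           trans (Ecoin-cong m (play-suc sA sB x y α)) (Ecoin-affine m 1ℚ (c x y) (Q x y α)))) ⟩
    E₂ (λ x y → Ecoin m (λ α → 1ℚ + c x y * Ecoin m (λ β → toℚ (play a b n (move sA x) (move sB y) α β))))
      ≡⟨ E₂-cong (λ x y → Ecoin-affine m 1ℚ (c x y) (λ α → Ecoin m (Q x y α))) ⟩
    E₂ (λ x y → 1ℚ + c x y * duration (move sA x) (move sB y) m)
      ≡⟨ E₂-c+ 1ℚ (λ x y → c x y * duration (move sA x) (move sB y) m) ⟩
    1ℚ + E₂ (λ x y → c x y * duration (move sA x) (move sB y) m)
      ∎
    where
    P : Bool → Bool → Vec Bool m → Vec Bool m → ℚ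
    P x y α β = toℚ (play a b n sA sB (x ∷ α) (y ∷ β))
    Q : Bool → Bool → Vec Bool m → Vec Bool m → ℚ
    Q x y α β = toℚ (play a b n (move sA x) (move sB y) α β)
    c : Bool → Bool → ℚ
    c x y = alive (move sA x) * alive (move sB y)

  -- The factor alive sA * alive sB is needed because play never checks the
  -- initial piles, whereas joint sA sB 0 is 0 unless both are below n.
  duration≡jointSum : ∀ m sA sB → alive sA * alive sB * duration sA sB m ≡ jointSum sA sB m
  duration≡jointSum zero    sA sB = *-zeroʳ (alive sA * alive sB)
  duration≡jointSum (suc m) sA sB = begin
    alive sA * alive sB * duration sA sB (suc m)
      ≡⟨ cong (alive sA * alive sB *_) (duration-suc sA sB m) ⟩
    alive sA * alive sB * (1ℚ + E₂ (λ x y → alive (move sA x) * alive (move sB y) * duration (move sA x) (move sB y) m))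
      ≡⟨ cong (λ z → alive sA * alive sB * (1ℚ + z)) (E₂-cong (λ x y → duration≡jointSum m (move sA x) (move sB y))) ⟩
    alive sA * alive sB * (1ℚ + E₂ (λ x y → jointSum (move sA x) (move sB y) m))
      ≡⟨ jointSum-suc sA sB m ⟨
    jointSum sA sB (suc m)
      ∎

qsqSum≡jointSum : ∀ a b n L → qsqSum a b n L ≡ Game.jointSum a b (+ n) (+ 0) (+ 0) L
qsqSum≡jointSum a b n zero    = refl
qsqSum≡jointSum a b n (suc L) = cong (_+ q a b n L * q a b n L) (qsqSum≡jointSum a b n L)

EXtrunc≡qsqSum : ∀ a b n → 1 ≤ n → ∀ m → EXtrunc a b n m ≡ qsqSum a b n m
-- Since 0 < n, the factor alive (+ 0) * alive (+ 0) below computes to 1ℚ.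
EXtrunc≡qsqSum a b (suc n) (s≤s _) m = begin
  EXtrunc a b (suc n) m                      ≡⟨ *-identityˡ _ ⟨
  1ℚ * EXtrunc a b (suc n) m                 ≡⟨ Game.duration≡jointSum a b (+ suc n) m (+ 0) (+ 0) ⟩
  Game.jointSum a b (+ suc n) (+ 0) (+ 0) m  ≡⟨ qsqSum≡jointSum a b (suc n) m ⟨
  qsqSum a b (suc n) m                       ∎

theorem4 : (a b : ℤ) (n : ℕ) → 1 ≤ n →
    (∀ m → ∃[ L ] EXtrunc a b n m ℚ.≤ qsqSum a b n L) ×
    (∀ L → ∃[ m ] qsqSum a b n L ℚ.≤ EXtrunc a b n m)
theorem4 a b n 1≤n =
  (λ m → m , ≤-reflexive (EXtrunc≡qsqSum a b n 1≤n m)) ,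
  (λ L → L , ≤-reflexive (sym (EXtrunc≡qsqSum a b n 1≤n L)))
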